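{- Let $\mathfrak F$ be a finite poset and $H=H_{\mathfrak F}$ its Heyting algebra of upsets. For all $x,y\in\mathfrak F$ the following are equivalent: (i) $x\sim_\infty y$; (ii) $\hat x\cap\langle H_\neg\rangle=\hat y\cap\langle H_\neg\rangle$, where $\hat z=\{U\in H: z\in U\}$ is the prime filter corresponding to $z$; (iii) for every $U\in\langle H_\neg\rangle$, $x\in U\iff y\in U$.
   Context: $H_\neg$ is the set of regular upsets $U=\neg\neg U$ (equivalently $U=((( U^\downarrow)^c)^\downarrow)^c$) and $\langle H_\neg\rangle$ the Heyting subalgebra generated by them. For $x\in\mathfrak F$, $M(x)$ is the set of maximal elements above $x$; $x\sim_0 y$ iff $M(x)=M(y)$; $x\sim_{n+1}y$ iff $\{[z]_n:z\ge x\}=\{[z]_n:z\ge y\}$, with $[z]_n$ the $\sim_n$-class; $\sim_\infty=\bigcap_{n<\omega}\sim_n$. -}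

module Defs where

open import Level using (0ℓ)
open import Data.Nat using (ℕ; zero; suc)
open import Data.Fin using (Fin)
open import Data.Fin.Subset using (Subset; _∈_; _∉_; inside; outside; Side) renaming (⊥ to ∅; ⊤ to Full; _∩_ to _∩ˢ_; _∪_ to _∪ˢ_)
open import Data.Fin.Subset.Properties using (_∈?_)
open import Data.Fin.Properties using (all?; _≟_)
open import Data.Vec using (tabulate)
open import Data.Product using (Σ; _×_; _,_)
open import Relation.Nullary using (Dec; yes; no; ¬_)
open import Relation.Nullary.Decidable using (_→-dec_; _×-dec_; ¬?)
open import Relation.Binary using (Rel; IsDecPartialOrder)
open import Relation.Binary.PropositionalEquality using (_≡_)

side : ∀ {p} {P : Set p} → Dec P → Side
side (yes _) = inside
side (no _)  = outside

module FinitePoset {n : ℕ} (_≤_ : Rel (Fin n) 0ℓ)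
                   (isDPO : IsDecPartialOrder _≡_ _≤_) where

  open IsDecPartialOrder isDPO using (_≤?_)

  IsUpset : Subset n → Set
  IsUpset U = ∀ x y → x ≤ y → x ∈ U → y ∈ U

  ⊥ᴴ ⊤ᴴ : Subset n
  ⊥ᴴ = ∅
  ⊤ᴴ = Full

  _∧ᴴ_ _∨ᴴ_ _⇒ᴴ_ : Subset n → Subset n → Subset n
  U ∧ᴴ V = U ∩ˢ V
  U ∨ᴴ V = U ∪ˢ V
  U ⇒ᴴ V = tabulate λ x →
    side (all? λ y → (x ≤? y) →-dec ((y ∈? U) →-dec (y ∈? V)))

  ¬ᴴ : Subset n → Subset n
  ¬ᴴ U = U ⇒ᴴ ⊥ᴴ

  IsRegular : Subset n → Set
  IsRegular U = IsUpset U × (U ≡ ¬ᴴ (¬ᴴ U))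

  data Gen : Subset n → Set where
    gen : ∀ {U} → IsRegular U → Gen U
    bot : Gen ⊥ᴴ
    top : Gen ⊤ᴴ
    meet : ∀ {U V} → Gen U → Gen V → Gen (U ∧ᴴ V)
    join : ∀ {U V} → Gen U → Gen V → Gen (U ∨ᴴ V)
    imp  : ∀ {U V} → Gen U → Gen V → Gen (U ⇒ᴴ V)

  IsMaximal : Fin n → Set
  IsMaximal z = ∀ w → z ≤ w → w ≡ z

  M : Fin n → Subset n
  M x = tabulate λ z → side ((x ≤? z) ×-dec (all? λ w → (z ≤? w) →-dec (w ≟ z)))

  -- x ∼ₖ y.  For k+1: {[z]ₖ : z ≥ x} = {[z]ₖ : z ≥ y}, i.e. every ∼ₖ-class
  -- met above x is met above y and vice versa.
  Sim : ℕ → Fin n → Fin n → Set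
  Sim zero    x y = M x ≡ M y
  Sim (suc k) x y =
    (∀ z → x ≤ z → Σ (Fin n) λ z' → y ≤ z' × Sim k z z') ×
    (∀ z' → y ≤ z' → Σ (Fin n) λ z → x ≤ z × Sim k z z')

  Sim∞ : Fin n → Fin n → Set
  Sim∞ x y = ∀ k → Sim k x y

  InHat : Fin n → Subset n → Set
  InHat z U = IsUpset U × z ∈ U

-- Every set of ⟨H_¬⟩ is a union of ∼ₖ-classes for some k: a regular upset
-- is determined by the maximal points it contains, hence is ∼₀-invariant,
-- and each Heyting operation raises the level needed by at most one, since
-- U ⇒ V only looks at the points above. Conversely, if x ≁ₖ y we build a
-- separating set by induction on k: for k = 0 the pseudocomplement of ↑m
-- for a maximal m above exactly one of them, and at level k+1, with z ≥ x
-- ∼ₖ-equivalent to no point above y, the set (⋂ Aᵢ) ⇒ (⋃ Bᵢ) assembled from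
-- level-k separators of z from each point above y. On a finite poset ∼ₖ is
-- decidable, so x ∼∞ y follows from inseparability.
module Submission where

open import Defs
open import Level using (0ℓ)
open import Data.Nat using (ℕ; zero; suc; _⊔_; _≤′_; ≤′-refl; ≤′-step) renaming (_≤_ to _≤ℕ_)
open import Data.Nat.Properties using (≤⇒≤′; m≤m⊔n; m≤n⊔m)
open import Data.Fin using (Fin)
open import Data.Fin.Subset using (Subset; _∈_; _∉_; _⊆_; inside) renaming (⊥ to ∅; ⊤ to Full; _∩_ to _∩ˢ_; _∪_ to _∪ˢ_)
open import Data.Fin.Subset.Properties using (_∈?_; _⊆?_; ∉⊥; ∈⊤; x∈p∩q⁺; x∈p∩q⁻; x∈p∪q⁺; x∈p∪q⁻; ⊆-antisym)
open import Data.Fin.Properties using (all?; any?; _≟_; ¬∀⟶∃¬)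
open import Data.Fin.Induction using (po-noetherian)
open import Data.Vec using (tabulate)
open import Data.Vec.Properties using (lookup∘tabulate; []=⇒lookup; lookup⇒[]=; ≡-dec)
open import Data.Bool using () renaming (_≟_ to _≟ᵇ_)
open import Data.Product using (∃; _×_; _,_; proj₁; proj₂; map₂)
open import Data.Sum using (_⊎_; inj₁; inj₂; [_,_])
open import Data.Empty using (⊥-elim)
open import Function.Base using (_∘_)
open import Function.Bundles using (_⇔_; mk⇔; Equivalence)
open import Function.Construct.Composition using (_⇔-∘_)
open import Function.Construct.Symmetry using (⇔-sym)
open import Induction.WellFounded using (Acc; acc)
open import Relation.Nullary using (Dec; yes; no; ¬_)
open import Relation.Nullary.Decidable using (_→-dec_; _×-dec_; ¬?; decidable-stable)
open import Relation.Unary using (Pred; Decidable)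
open import Relation.Binary using (Rel; IsDecPartialOrder; _Respects_)
open import Relation.Binary.PropositionalEquality using (_≡_; refl; sym; trans; subst)

private
  variable
    n k : ℕ

¬→⇒×¬ : ∀ {A B : Set} → Dec A → ¬ (A → B) → A × ¬ B
¬→⇒×¬ A? ¬f = decidable-stable A? (λ ¬a → ¬f (λ a → ⊥-elim (¬a a))) , λ b → ¬f (λ _ → b)

⊈⇒∃∈∉ : {p q : Subset n} → ¬ p ⊆ q → ∃ λ x → x ∈ p × x ∉ q
⊈⇒∃∈∉ {n} {p} {q} p⊈q =
  let x , ¬x∈p⇒x∈q = ¬∀⟶∃¬ n _ (λ x → x ∈? p →-dec x ∈? q) (λ f → p⊈q (λ {x} → f x))
  in x , ¬→⇒×¬ (x ∈? p) ¬x∈p⇒x∈q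

side-inside⇔ : ∀ {P : Set} (P? : Dec P) → side P? ≡ inside ⇔ P
side-inside⇔ (yes p) = mk⇔ (λ _ → p) (λ _ → refl)
side-inside⇔ (no ¬p) = mk⇔ (λ ()) (λ p → ⊥-elim (¬p p))

∈-tabulate⇔ : {P : Pred (Fin n) 0ℓ} (P? : Decidable P) {x : Fin n} →
              x ∈ tabulate (λ z → side (P? z)) ⇔ P x
∈-tabulate⇔ P? {x} = mk⇔
  (λ x∈ → Equivalence.to (side-inside⇔ (P? x)) (trans (sym (lookup∘tabulate _ x)) ([]=⇒lookup x∈)))
  (λ px → lookup⇒[]= x _ (trans (lookup∘tabulate _ x) (Equivalence.from (side-inside⇔ (P? x)) px)))

⋂ᶠ ⋃ᶠ : ∀ {m} → (Fin m → Subset n) → Subset n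
⋂ᶠ {m = zero}  f = Full
⋂ᶠ {m = suc m} f = f Fin.zero ∩ˢ ⋂ᶠ (λ i → f (Fin.suc i))
⋃ᶠ {m = zero}  f = ∅
⋃ᶠ {m = suc m} f = f Fin.zero ∪ˢ ⋃ᶠ (λ i → f (Fin.suc i))

∈⋂ᶠ⁺ : ∀ {m} (f : Fin m → Subset n) {x} → (∀ i → x ∈ f i) → x ∈ ⋂ᶠ f
∈⋂ᶠ⁺ {m = zero}  f x∈f = ∈⊤
∈⋂ᶠ⁺ {m = suc m} f x∈f = x∈p∩q⁺ (x∈f Fin.zero , ∈⋂ᶠ⁺ _ (λ i → x∈f (Fin.suc i)))

∈⋂ᶠ⁻ : ∀ {m} (f : Fin m → Subset n) {x} → x ∈ ⋂ᶠ f → ∀ i → x ∈ f i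
∈⋂ᶠ⁻ {m = suc m} f x∈⋂ Fin.zero    = proj₁ (x∈p∩q⁻ (f Fin.zero) _ x∈⋂)
∈⋂ᶠ⁻ {m = suc m} f x∈⋂ (Fin.suc i) = ∈⋂ᶠ⁻ _ (proj₂ (x∈p∩q⁻ (f Fin.zero) _ x∈⋂)) i

∈⋃ᶠ⁺ : ∀ {m} (f : Fin m → Subset n) {x} i → x ∈ f i → x ∈ ⋃ᶠ f
∈⋃ᶠ⁺ {m = suc m} f Fin.zero    x∈f = x∈p∪q⁺ (inj₁ x∈f)
∈⋃ᶠ⁺ {m = suc m} f (Fin.suc i) x∈f = x∈p∪q⁺ (inj₂ (∈⋃ᶠ⁺ _ i x∈f))

∈⋃ᶠ⁻ : ∀ {m} (f : Fin m → Subset n) {x} → x ∈ ⋃ᶠ f → ∃ λ i → x ∈ f i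
∈⋃ᶠ⁻ {m = zero}  f x∈⋃ = ⊥-elim (∉⊥ x∈⋃)
∈⋃ᶠ⁻ {m = suc m} f x∈⋃ with x∈p∪q⁻ (f Fin.zero) _ x∈⋃
... | inj₁ x∈f₀ = Fin.zero , x∈f₀
... | inj₂ x∈⋃′ = let i , x∈fᵢ = ∈⋃ᶠ⁻ _ x∈⋃′ in Fin.suc i , x∈fᵢ

module _ {n : ℕ} (_≤_ : Rel (Fin n) 0ℓ) (isDPO : IsDecPartialOrder _≡_ _≤_) where

  open FinitePoset _≤_ isDPO
  open IsDecPartialOrder isDPO using (_≤?_; isPartialOrder) renaming (refl to ≤-refl; trans to ≤-trans)

  private
    variable
      x y z w : Fin n
      U V : Subset n

  ∈⇒ᴴ⇔ : x ∈ U ⇒ᴴ V ⇔ (∀ y → x ≤ y → y ∈ U → y ∈ V)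
  ∈⇒ᴴ⇔ {x} {U} {V} = ∈-tabulate⇔ (λ x → all? λ y → (x ≤? y) →-dec ((y ∈? U) →-dec (y ∈? V)))

  ∈⇒ᴴ⁺ : (∀ y → x ≤ y → y ∈ U → y ∈ V) → x ∈ U ⇒ᴴ V
  ∈⇒ᴴ⁺ = Equivalence.from ∈⇒ᴴ⇔

  ∈⇒ᴴ⁻ : x ∈ U ⇒ᴴ V → ∀ y → x ≤ y → y ∈ U → y ∈ V
  ∈⇒ᴴ⁻ = Equivalence.to ∈⇒ᴴ⇔

  ⇒ᴴ-upset : ∀ U V → IsUpset (U ⇒ᴴ V)
  ⇒ᴴ-upset U V x y x≤y x∈ = ∈⇒ᴴ⁺ λ z y≤z → ∈⇒ᴴ⁻ x∈ z (≤-trans x≤y y≤z)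

  ∈¬ᴴ⁺ : (∀ y → x ≤ y → y ∉ U) → x ∈ ¬ᴴ U
  ∈¬ᴴ⁺ none = ∈⇒ᴴ⁺ λ y x≤y y∈U → ⊥-elim (none y x≤y y∈U)

  ∈¬ᴴ⁻ : x ∈ ¬ᴴ U → x ≤ y → y ∉ U
  ∈¬ᴴ⁻ x∈¬U x≤y y∈U = ∉⊥ (∈⇒ᴴ⁻ x∈¬U _ x≤y y∈U)

  ¬ᴴ-antitone : U ⊆ V → ¬ᴴ V ⊆ ¬ᴴ U
  ¬ᴴ-antitone U⊆V x∈¬V = ∈¬ᴴ⁺ λ y x≤y y∈U → ∈¬ᴴ⁻ x∈¬V x≤y (U⊆V y∈U)

  ⊆¬¬ᴴ : IsUpset U → U ⊆ ¬ᴴ (¬ᴴ U)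
  ⊆¬¬ᴴ upU {x} x∈U = ∈¬ᴴ⁺ λ y x≤y y∈¬U → ∈¬ᴴ⁻ y∈¬U ≤-refl (upU x y x≤y x∈U)

  ¬ᴴ-regular : IsUpset U → IsRegular (¬ᴴ U)
  ¬ᴴ-regular {U} upU =
    ⇒ᴴ-upset U ⊥ᴴ , ⊆-antisym (⊆¬¬ᴴ (⇒ᴴ-upset U ⊥ᴴ)) (¬ᴴ-antitone (⊆¬¬ᴴ upU))

  Gen-upset : Gen U → IsUpset U
  Gen-upset (gen (upU , _)) = upU
  Gen-upset bot x y _ x∈∅ = ⊥-elim (∉⊥ x∈∅)
  Gen-upset top x y _ _ = ∈⊤
  Gen-upset (meet {U} {V} gU gV) x y x≤y x∈ =
    let x∈U , x∈V = x∈p∩q⁻ U V x∈ in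
    x∈p∩q⁺ (Gen-upset gU x y x≤y x∈U , Gen-upset gV x y x≤y x∈V)
  Gen-upset (join {U} {V} gU gV) x y x≤y x∈ with x∈p∪q⁻ U V x∈
  ... | inj₁ x∈U = x∈p∪q⁺ (inj₁ (Gen-upset gU x y x≤y x∈U))
  ... | inj₂ x∈V = x∈p∪q⁺ (inj₂ (Gen-upset gV x y x≤y x∈V))
  Gen-upset (imp {U} {V} _ _) = ⇒ᴴ-upset U V

  Gen-⋂ᶠ : ∀ {m} (f : Fin m → Subset n) → (∀ i → Gen (f i)) → Gen (⋂ᶠ f)
  Gen-⋂ᶠ {m = zero}  f gf = top
  Gen-⋂ᶠ {m = suc m} f gf = meet (gf Fin.zero) (Gen-⋂ᶠ _ (λ i → gf (Fin.suc i)))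

  Gen-⋃ᶠ : ∀ {m} (f : Fin m → Subset n) → (∀ i → Gen (f i)) → Gen (⋃ᶠ f)
  Gen-⋃ᶠ {m = zero}  f gf = bot
  Gen-⋃ᶠ {m = suc m} f gf = join (gf Fin.zero) (Gen-⋃ᶠ _ (λ i → gf (Fin.suc i)))

  ↑ : Fin n → Subset n
  ↑ m = tabulate λ z → side (m ≤? z)

  ∈↑⇔ : ∀ {m} → z ∈ ↑ m ⇔ m ≤ z
  ∈↑⇔ {m = m} = ∈-tabulate⇔ (m ≤?_)

  ↑-upset : ∀ m → IsUpset (↑ m)
  ↑-upset m x y x≤y x∈↑m = Equivalence.from ∈↑⇔ (≤-trans (Equivalence.to ∈↑⇔ x∈↑m) x≤y)

  ∈M⇔ : ∀ {m} → m ∈ M x ⇔ (x ≤ m × IsMaximal m)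
  ∈M⇔ {x} = ∈-tabulate⇔ (λ z → (x ≤? z) ×-dec (all? λ w → (z ≤? w) →-dec (w ≟ z)))

  maximal-above : ∀ w → ∃ λ m → w ≤ m × IsMaximal m
  maximal-above w = climb (po-noetherian isPartialOrder w)
    where
    climb : ∀ {w} → Acc _ w → ∃ λ m → w ≤ m × IsMaximal m
    climb {w} (acc above) with any? (λ v → (w ≤? v) ×-dec ¬? (w ≟ v))
    ... | yes (v , w≤v , w≢v) = let m , v≤m , max = climb (above (w≤v , w≢v)) in m , ≤-trans w≤v v≤m , max
    ... | no  none = w , ≤-refl , λ v w≤v → sym (decidable-stable (w ≟ v) λ w≢v → none (v , w≤v , w≢v))

  Forth : ℕ → Fin n → Fin n → Set
  Forth k x y = ∀ z → x ≤ z → ∃ λ z′ → y ≤ z′ × Sim k z z′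

  Sim-sym : ∀ k → Sim k x y → Sim k y x
  Sim-sym zero    M≡ = sym M≡
  Sim-sym (suc k) (forth , back) =
    (λ z y≤z → map₂ (map₂ (Sim-sym k)) (back z y≤z)) ,
    (λ z x≤z → map₂ (map₂ (Sim-sym k)) (forth z x≤z))

  Forth⇒⊆M : Forth 0 x y → M x ⊆ M y
  Forth⇒⊆M forth m∈Mx =
    let x≤m , max = Equivalence.to ∈M⇔ m∈Mx
        z′ , y≤z′ , Mm≡Mz′ = forth _ x≤m
        z′≤m , _ = Equivalence.to ∈M⇔ (subst (_ ∈_) Mm≡Mz′ (Equivalence.from ∈M⇔ (≤-refl , max)))
    in Equivalence.from ∈M⇔ (≤-trans y≤z′ z′≤m , max)

  Sim-pred : ∀ k → Sim (suc k) x y → Sim k x y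
  Sim-pred zero    s@(forth , _) = ⊆-antisym (Forth⇒⊆M forth) (Forth⇒⊆M (proj₁ (Sim-sym 1 s)))
  Sim-pred (suc k) (forth , back) =
    (λ z x≤z → map₂ (map₂ (Sim-pred k)) (forth z x≤z)) ,
    (λ z y≤z → map₂ (map₂ (Sim-pred k)) (back z y≤z))

  Sim-antitone : ∀ {k l} → k ≤′ l → Sim l x y → Sim k x y
  Sim-antitone ≤′-refl        = λ s → s
  Sim-antitone (≤′-step k≤′l) = λ s → Sim-antitone k≤′l (Sim-pred _ s)

  Forth? : ∀ k x y → Dec (Forth k x y)
  Sim? : ∀ k x y → Dec (Sim k x y)
  Forth? k x y = all? λ z → (x ≤? z) →-dec any? λ z′ → (y ≤? z′) ×-dec Sim? k z z′
  Sim? zero    x y = ≡-dec _≟ᵇ_ (M x) (M y)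
  Sim? (suc k) x y = Forth? k x y ×-dec (all? λ z′ → (y ≤? z′) →-dec any? λ z → (x ≤? z) ×-dec Sim? k z z′)

  Respects-Sim : ℕ → Subset n → Set
  Respects-Sim k U = (_∈ U) Respects Sim k

  Respects-Sim-mono : ∀ {k l} → k ≤ℕ l → Respects-Sim k U → Respects-Sim l U
  Respects-Sim-mono k≤l rU s = rU (Sim-antitone (≤⇒≤′ k≤l) s)

  Respects-Sim-common : ∀ {U V} → ∃ (λ k → Respects-Sim k U) → ∃ (λ k → Respects-Sim k V) →
                        ∃ λ k → Respects-Sim k U × Respects-Sim k V
  Respects-Sim-common (k , rU) (l , rV) =
    k ⊔ l , Respects-Sim-mono (m≤m⊔n k l) rU , Respects-Sim-mono (m≤n⊔m k l) rV

  -- A point w ≥ y of ¬U would lie below some m ∈ M y = M x, and that m is in U.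
  regular-respects-Sim₀ : IsRegular U → Respects-Sim 0 U
  regular-respects-Sim₀ {U} (upU , U≡¬¬U) {x} {y} Mx≡My x∈U =
    subst (y ∈_) (sym U≡¬¬U) (∈¬ᴴ⁺ λ w y≤w w∈¬U →
      let m , w≤m , max = maximal-above w
          x≤m , _ = Equivalence.to ∈M⇔ (subst (m ∈_) (sym Mx≡My) (Equivalence.from ∈M⇔ (≤-trans y≤w w≤m , max)))
      in ∈¬ᴴ⁻ w∈¬U w≤m (upU x m x≤m x∈U))

  ∩-respects-Sim : Respects-Sim k U → Respects-Sim k V → Respects-Sim k (U ∩ˢ V)
  ∩-respects-Sim {U = U} {V} rU rV s x∈ =
    let x∈U , x∈V = x∈p∩q⁻ U V x∈ in x∈p∩q⁺ (rU s x∈U , rV s x∈V)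

  ∪-respects-Sim : Respects-Sim k U → Respects-Sim k V → Respects-Sim k (U ∪ˢ V)
  ∪-respects-Sim {U = U} {V} rU rV s x∈ with x∈p∪q⁻ U V x∈
  ... | inj₁ x∈U = x∈p∪q⁺ (inj₁ (rU s x∈U))
  ... | inj₂ x∈V = x∈p∪q⁺ (inj₂ (rV s x∈V))

  ⇒ᴴ-respects-Sim : Respects-Sim k U → Respects-Sim k V → Respects-Sim (suc k) (U ⇒ᴴ V)
  ⇒ᴴ-respects-Sim {k} rU rV (_ , back) x∈U⇒V = ∈⇒ᴴ⁺ λ z′ y≤z′ z′∈U →
    let z , x≤z , z∼z′ = back z′ y≤z′
    in rV z∼z′ (∈⇒ᴴ⁻ x∈U⇒V z x≤z (rU (Sim-sym k z∼z′) z′∈U))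

  Gen-respects-Sim : Gen U → ∃ λ k → Respects-Sim k U
  Gen-respects-Sim (gen regU) = 0 , regular-respects-Sim₀ regU
  Gen-respects-Sim bot = 0 , λ _ x∈∅ → ⊥-elim (∉⊥ x∈∅)
  Gen-respects-Sim top = 0 , λ _ _ → ∈⊤
  Gen-respects-Sim (meet gU gV) =
    let k , rU , rV = Respects-Sim-common (Gen-respects-Sim gU) (Gen-respects-Sim gV) in k , ∩-respects-Sim rU rV
  Gen-respects-Sim (join gU gV) =
    let k , rU , rV = Respects-Sim-common (Gen-respects-Sim gU) (Gen-respects-Sim gV) in k , ∪-respects-Sim rU rV
  Gen-respects-Sim (imp gU gV) =
    let k , rU , rV = Respects-Sim-common (Gen-respects-Sim gU) (Gen-respects-Sim gV) in suc k , ⇒ᴴ-respects-Sim rU rV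

  Separable : Fin n → Fin n → Set
  Separable x y = ∃ λ U → Gen U × x ∈ U × y ∉ U

  maximal-separates : ∀ {m} → m ∈ M x → m ∉ M y → Separable y x
  maximal-separates {x} {y} {m} m∈Mx m∉My =
    ¬ᴴ (↑ m) , gen (¬ᴴ-regular (↑-upset m)) , y∈¬↑m , x∉¬↑m
    where
    x≤m = proj₁ (Equivalence.to ∈M⇔ m∈Mx)
    max = proj₂ (Equivalence.to ∈M⇔ m∈Mx)
    y∈¬↑m : y ∈ ¬ᴴ (↑ m)
    y∈¬↑m = ∈¬ᴴ⁺ λ w y≤w w∈↑m →
      m∉My (Equivalence.from ∈M⇔ (subst (y ≤_) (max w (Equivalence.to ∈↑⇔ w∈↑m)) y≤w , max))
    x∉¬↑m : x ∉ ¬ᴴ (↑ m)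
    x∉¬↑m x∈¬↑m = ∈¬ᴴ⁻ x∈¬↑m x≤m (Equivalence.from ∈↑⇔ ≤-refl)

  -- Both kinds of separator of z from w (z ∈ U ∌ w, or w ∈ U ∌ z) in one shape;
  -- a w not above y gets the trivial cut (Full, ∅).
  record Cut (z y w : Fin n) : Set where
    field
      lower upper : Subset n
      lower-gen : Gen lower
      upper-gen : Gen upper
      z∈lower : z ∈ lower
      z∉upper : z ∉ upper
      crosses : y ≤ w → w ∈ lower → w ∈ upper

  cut : (y ≤ w → Separable z w ⊎ Separable w z) → Cut z y w
  cut {y} {w} sep with y ≤? w
  ... | no y≰w = record { lower = Full ; upper = ∅ ; lower-gen = top ; upper-gen = bot
                        ; z∈lower = ∈⊤ ; z∉upper = ∉⊥ ; crosses = λ y≤w → ⊥-elim (y≰w y≤w) }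
  ... | yes y≤w with sep y≤w
  ...   | inj₁ (U , gU , z∈U , w∉U) =
          record { lower = U ; upper = ∅ ; lower-gen = gU ; upper-gen = bot
                 ; z∈lower = z∈U ; z∉upper = ∉⊥ ; crosses = λ _ w∈U → ⊥-elim (w∉U w∈U) }
  ...   | inj₂ (U , gU , w∈U , z∉U) =
          record { lower = Full ; upper = U ; lower-gen = top ; upper-gen = gU
                 ; z∈lower = ∈⊤ ; z∉upper = z∉U ; crosses = λ _ _ → w∈U }

  cuts-separate : x ≤ z → (∀ w → Cut z y w) → Separable y x
  cuts-separate {x} {z} {y} x≤z cuts =
    ⋂ᶠ lower ⇒ᴴ ⋃ᶠ upper ,
    imp (Gen-⋂ᶠ lower (Cut.lower-gen ∘ cuts)) (Gen-⋃ᶠ upper (Cut.upper-gen ∘ cuts)) ,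
    ∈⇒ᴴ⁺ (λ w y≤w w∈⋂ → ∈⋃ᶠ⁺ upper w (Cut.crosses (cuts w) y≤w (∈⋂ᶠ⁻ lower w∈⋂ w))) ,
    λ x∈ → let i , z∈upperᵢ = ∈⋃ᶠ⁻ upper (∈⇒ᴴ⁻ x∈ z x≤z (∈⋂ᶠ⁺ lower (Cut.z∈lower ∘ cuts)))
           in Cut.z∉upper (cuts i) z∈upperᵢ
    where
    lower upper : Fin n → Subset n
    lower w = Cut.lower (cuts w)
    upper w = Cut.upper (cuts w)

  separate : ∀ k x y → ¬ Sim k x y → Separable x y ⊎ Separable y x
  ¬Forth-separate : ∀ k x y → ¬ Forth k x y → Separable y x

  separate zero x y Mx≢My with M x ⊆? M y | M y ⊆? M x
  ... | yes Mx⊆My | yes My⊆Mx = ⊥-elim (Mx≢My (⊆-antisym Mx⊆My My⊆Mx))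
  ... | no Mx⊈My | _ = let m , m∈Mx , m∉My = ⊈⇒∃∈∉ Mx⊈My in inj₂ (maximal-separates m∈Mx m∉My)
  ... | _ | no My⊈Mx = let m , m∈My , m∉Mx = ⊈⇒∃∈∉ My⊈Mx in inj₁ (maximal-separates m∈My m∉Mx)
  separate (suc k) x y ≁ with Forth? k x y | Forth? k y x
  ... | no ¬forth | _ = inj₂ (¬Forth-separate k x y ¬forth)
  ... | _ | no ¬back = inj₁ (¬Forth-separate k y x ¬back)
  ... | yes forth | yes back = ⊥-elim (≁ (forth , λ z′ y≤z′ → map₂ (map₂ (Sim-sym k)) (back z′ y≤z′)))

  ¬Forth-separate k x y ¬forth with ¬∀⟶∃¬ n _ (λ z → (x ≤? z) →-dec any? λ z′ → (y ≤? z′) ×-dec Sim? k z z′) ¬forth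
  ... | z , ¬[x≤z⇒match] =
    let x≤z , ¬match = ¬→⇒×¬ (x ≤? z) ¬[x≤z⇒match]
    in cuts-separate x≤z λ w → cut λ y≤w → separate k z w λ z∼w → ¬match (w , y≤w , z∼w)

  Sim∞⇔inseparable : Sim∞ x y ⇔ (∀ U → Gen U → x ∈ U ⇔ y ∈ U)
  Sim∞⇔inseparable {x} {y} = mk⇔ inseparable sim
    where
    inseparable : Sim∞ x y → ∀ U → Gen U → x ∈ U ⇔ y ∈ U
    inseparable x∼y U gU =
      let k , rU = Gen-respects-Sim gU in mk⇔ (rU (x∼y k)) (rU (Sim-sym k (x∼y k)))
    sim : (∀ U → Gen U → x ∈ U ⇔ y ∈ U) → Sim∞ x y
    sim ins k = decidable-stable (Sim? k x y) λ x≁y →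
      [ (λ (U , gU , x∈U , y∉U) → y∉U (Equivalence.to (ins U gU) x∈U))
      , (λ (U , gU , y∈U , x∉U) → x∉U (Equivalence.from (ins U gU) y∈U)) ] (separate k x y x≁y)

  hat⇔inseparable : (∀ U → (InHat x U × Gen U) ⇔ (InHat y U × Gen U)) ⇔ (∀ U → Gen U → x ∈ U ⇔ y ∈ U)
  hat⇔inseparable {x} {y} = mk⇔
    (λ hat U gU → mk⇔ (λ x∈U → proj₂ (proj₁ (Equivalence.to   (hat U) ((Gen-upset gU , x∈U) , gU))))
                      (λ y∈U → proj₂ (proj₁ (Equivalence.from (hat U) ((Gen-upset gU , y∈U) , gU)))))
    (λ ins U → mk⇔ (λ ((upU , x∈U) , gU) → (upU , Equivalence.to   (ins U gU) x∈U) , gU)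
                   (λ ((upU , y∈U) , gU) → (upU , Equivalence.from (ins U gU) y∈U) , gU))

proposition3p17 : (n : ℕ) (_≤_ : Rel (Fin n) 0ℓ) (isDPO : IsDecPartialOrder _≡_ _≤_) (x y : Fin n) →
    let open FinitePoset _≤_ isDPO in
      ((Sim∞ x y ⇔ (∀ (U : Subset n) → (InHat x U × Gen U) ⇔ (InHat y U × Gen U)))
      × (Sim∞ x y ⇔ (∀ (U : Subset n) → Gen U → (x ∈ U ⇔ y ∈ U))))
proposition3p17 n _≤_ isDPO x y =
  ⇔-sym (hat⇔inseparable _≤_ isDPO) ⇔-∘ Sim∞⇔inseparable _≤_ isDPO , Sim∞⇔inseparable _≤_ isDPO
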